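{- Let $a,b,c$ be nonzero reals with $a^2b^2+4abc>0$ and $c^2-ab-2c+1\neq0$, and let $w_0,w_1\in\mathbb{R}$. For every integer $n\ge1$, $$\sum_{r=1}^{n}\mathbb{K}_{w,r}=\frac{c^2\left(\mathbb{K}_{w,n}+\mathbb{K}_{w,n-1}-\mathbb{K}_{w,0}-\mathbb{K}_{w,-1}\right)-\mathbb{K}_{w,n+2}-\mathbb{K}_{w,n+1}+\mathbb{K}_{w,2}+\mathbb{K}_{w,1}}{c^2-ab-2c+1}.$$
   Context: Hybrid numbers are expressions $x+yi+z\epsilon+th$ ($x,y,z,t\in\mathbb{R}$) with componentwise addition and real scalar multiplication (division by a nonzero real means multiplication by its inverse). Let $\chi(n)=a$ for even $n$, $b$ for odd $n$; $(w_n)_{n\ge0}$ satisfies $w_n=\chi(n)w_{n-1}+cw_{n-2}$ ($n\ge2$), and $u$ satisfies the same recurrence with $u_0=0,u_1=1$. $\xi(n)=n-2\lfloor n/2\rfloor$; for $n\ge1$, $w_{ -n}$ is defined by $(-c)^nw_{ -n}=(\frac ba)^{\xi(n)}w_0u_{n+1}-w_1u_n$. For every integer $m$, $\mathbb{K}_{w,m}=w_m+w_{m+1}i+w_{m+2}\epsilon+w_{m+3}h$. -}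

module Defs where

open import Level using (0ℓ)
open import Data.Nat as ℕ using (ℕ; zero; suc)
open import Data.Integer as ℤ using (ℤ; +_; -[1+_])
open import Data.Sum using (_⊎_)
open import Data.Product using (Σ; ∃; _×_; _,_)
open import Relation.Binary.PropositionalEquality using (_≡_; _≢_)
open import Relation.Binary.Structures using (IsStrictTotalOrder)
open import Algebra.Structures using (IsCommutativeRing)

-- The real numbers, axiomatised as a complete ordered field
-- (any model is isomorphic to ℝ).

record RealField : Set₁ where
  infixl 6 _+_ _-_
  infixl 7 _*_
  infix 4 _<_ _≤_
  field
    Carrier : Set
    _+_ _*_ : Carrier → Carrier → Carrier
    -_      : Carrier → Carrier
    0# 1#   : Carrier
    _<_     : Carrier → Carrier → Set
    isCommutativeRing : IsCommutativeRing _≡_ _+_ _*_ -_ 0# 1#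
    _⁻¹     : (x : Carrier) → x ≢ 0# → Carrier
    ⁻¹-inverse : ∀ x (x≢0 : x ≢ 0#) → x * (x ⁻¹) x≢0 ≡ 1#
    isStrictTotalOrder : IsStrictTotalOrder _≡_ _<_
    0<1     : 0# < 1#
    +-mono-< : ∀ {x y} z → x < y → x + z < y + z
    *-pos   : ∀ {x y} → 0# < x → 0# < y → 0# < x * y

  _≤_ : Carrier → Carrier → Set
  x ≤ y = (x < y) ⊎ (x ≡ y)

  _-_ : Carrier → Carrier → Carrier
  x - y = x + (- y)

  field
    complete : (P : Carrier → Set) → Σ Carrier P →
               Σ Carrier (λ M → ∀ x → P x → x ≤ M) →
               Σ Carrier (λ s → (∀ x → P x → x ≤ s) ×
                                (∀ M → (∀ x → P x → x ≤ M) → s ≤ M))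

-- Hybrid numbers  x + y i + z ε + t h  over a carrier.

record Hybrid (A : Set) : Set where
  constructor hyb
  field
    re ci ce ch : A

module Theory (R : RealField) where
  open RealField R

  infixl 6 _⊕_ _⊖_
  infixl 7 _·_

  _⊕_ : Hybrid Carrier → Hybrid Carrier → Hybrid Carrier
  hyb x y z t ⊕ hyb x' y' z' t' = hyb (x + x') (y + y') (z + z') (t + t')

  _⊖_ : Hybrid Carrier → Hybrid Carrier → Hybrid Carrier
  hyb x y z t ⊖ hyb x' y' z' t' = hyb (x - x') (y - y') (z - z') (t - t')

  _·_ : Carrier → Hybrid Carrier → Hybrid Carrier
  r · hyb x y z t = hyb (r * x) (r * y) (r * z) (r * t)

  hzero : Hybrid Carrier
  hzero = hyb 0# 0# 0# 0#

  _^_ : Carrier → ℕ → Carrier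
  x ^ zero  = 1#
  x ^ suc n = x * (x ^ n)

  χ : (a b : Carrier) → ℕ → Carrier
  χ a b n with n ℕ.% 2
  ... | zero  = a
  ... | suc _ = b

  wN : (a b c w₀ w₁ : Carrier) → ℕ → Carrier
  wN a b c w₀ w₁ zero = w₀
  wN a b c w₀ w₁ (suc zero) = w₁
  wN a b c w₀ w₁ (suc (suc n)) =
    χ a b (suc (suc n)) * wN a b c w₀ w₁ (suc n) + c * wN a b c w₀ w₁ n

  u : (a b c : Carrier) → ℕ → Carrier
  u a b c = wN a b c 0# 1#

  baξ : (a b : Carrier) → a ≢ 0# → ℕ → Carrier
  baξ a b a≢0 n = (b * (a ⁻¹) a≢0) ^ (n ℕ.% 2)

  -- w_m for every integer m; for n ≥ 1 the paper defines w_{-n} by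
  -- (-c)^n w_{-n} = (b/a)^ξ(n) w_0 u_{n+1} - w_1 u_n,
  -- i.e. w_{-n} = ((-c)^{-1})^n ((b/a)^ξ(n) w_0 u_{n+1} - w_1 u_n),
  -- where (-c)^{-1} = -(c^{-1}).
  w : (a b c w₀ w₁ : Carrier) → a ≢ 0# → c ≢ 0# → ℤ → Carrier
  w a b c w₀ w₁ a≢0 c≢0 (+ n) = wN a b c w₀ w₁ n
  w a b c w₀ w₁ a≢0 c≢0 -[1+ k ] =
    ((- ((c ⁻¹) c≢0)) ^ n)
      * (baξ a b a≢0 n * w₀ * u a b c (suc n) - w₁ * u a b c n)
    where
    n = suc k

  𝕂 : (a b c w₀ w₁ : Carrier) → a ≢ 0# → c ≢ 0# → ℤ → Hybrid Carrier
  𝕂 a b c w₀ w₁ a≢0 c≢0 m =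
    hyb (w a b c w₀ w₁ a≢0 c≢0 m)
        (w a b c w₀ w₁ a≢0 c≢0 (m ℤ.+ ℤ.+ 1))
        (w a b c w₀ w₁ a≢0 c≢0 (m ℤ.+ ℤ.+ 2))
        (w a b c w₀ w₁ a≢0 c≢0 (m ℤ.+ ℤ.+ 3))

  sumFrom1 : (ℕ → Hybrid Carrier) → ℕ → Hybrid Carrier
  sumFrom1 f zero    = hzero
  sumFrom1 f (suc n) = sumFrom1 f n ⊕ f (suc n)

module Submission where

-- Although w_n = χ(n) w_{n-1} + c w_{n-2} has period-two
-- coefficients, every sequence of the family obeys the constant-coefficient
-- recurrence with step two
--     w_{t+4} = (2c + ab) w_{t+2} - c² w_t           (t ≥ -1),
-- because χ(n) χ(n+1) = ab.  For any sequence g with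
-- g(t+4) = A g(t+2) - B g(t) the quantity
--     E(n) = B (g(n+1) + g(n)) - g(n+3) - g(n+2)
-- has increments E(n+1) - E(n) = (1 - A + B) g(n+2), so telescoping gives
-- (1 - A + B) Σ g = E(n) - E(0).  With A = 2c + ab and B = c² the factor
-- 1 - A + B is the denominator c² - ab - 2c + 1 of the theorem.  A hybrid
-- number is a quadruple of reals and all operations are componentwise, so
-- the theorem is this scalar formula applied to the four shifted sequences
-- (w_{t+j})_t, j = 0,1,2,3.

open import Defs
open import Data.Nat using (ℕ; _≥_)
open import Data.Integer using (ℤ; +_; -[1+_])
open import Data.Product using (_×_)
open import Relation.Binary.PropositionalEquality using (_≡_; _≢_)

open import Data.Nat as ℕ using (zero; suc)
import Data.Nat.Properties as ℕ
import Data.Integer as ℤ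
import Data.Integer.Properties as ℤ
open import Level using (0ℓ)
open import Data.Maybe using (Maybe; just; nothing)
open import Relation.Nullary using (yes; no)
open import Relation.Binary.PropositionalEquality as ≡ using (cong)
open import Algebra.Bundles using (CommutativeRing)
open import Algebra.Solver.Ring.AlmostCommutativeRing
  using (fromCommutativeRing; _-Raw-AlmostCommutative⟶_)

-- Every commutative ring R receives the canonical ring map ℤ → R.  Feeding
-- it to the library's ring solver gives a decision procedure for polynomial
-- identities with integer constants, valid in every commutative ring.
module IntegerCoefficients {a ℓ} (R : CommutativeRing a ℓ) where

  open CommutativeRing R
  -- n ×ᴺ x = x + ⋯ + x (n times), with 1 ×ᴺ x = x definitionally, so that
  -- the solver's constant 1 is literally 1#.
  open import Algebra.Properties.Semiring.Mult.TCOptimised semiring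
    using (1+×; ×-homo-+; ×1-homo-*) renaming (_×_ to _×ᴺ_)
  open import Algebra.Properties.Ring ring
    using (-0#≈0#; -‿involutive; -‿+-comm; -‿distribˡ-*; -‿distribʳ-*; xyx⁻¹≈y)
  open import Relation.Binary.Reasoning.Setoid setoid

  ⟦_⟧ℤ : ℤ → Carrier
  ⟦ + n ⟧ℤ     = n ×ᴺ 1#
  ⟦ -[1+ n ] ⟧ℤ = - (suc n ×ᴺ 1#)

  ⟦⟧-cong : ∀ {i j} → i ≡ j → ⟦ i ⟧ℤ ≈ ⟦ j ⟧ℤ
  ⟦⟧-cong i≡j = reflexive (cong ⟦_⟧ℤ i≡j)

  ⟦⟧-neg : ∀ i → ⟦ ℤ.- i ⟧ℤ ≈ - ⟦ i ⟧ℤ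
  ⟦⟧-neg (+ zero)  = sym -0#≈0#
  ⟦⟧-neg (+ suc n) = refl
  ⟦⟧-neg -[1+ n ]  = sym (-‿involutive _)

  ⟦⟧-⊖ : ∀ m n → ⟦ m ℤ.⊖ n ⟧ℤ ≈ m ×ᴺ 1# - n ×ᴺ 1#
  ⟦⟧-⊖ zero    zero    = sym (-‿inverseʳ 0#)
  ⟦⟧-⊖ zero    (suc n) = sym (+-identityˡ _)
  ⟦⟧-⊖ (suc m) zero    = sym (trans (+-congˡ -0#≈0#) (+-identityʳ _))
  ⟦⟧-⊖ (suc m) (suc n) = begin
    ⟦ suc m ℤ.⊖ suc n ⟧ℤ   ≈⟨ ⟦⟧-cong (ℤ.[1+m]⊖[1+n]≡m⊖n m n) ⟩
    ⟦ m ℤ.⊖ n ⟧ℤ           ≈⟨ ⟦⟧-⊖ m n ⟩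
    x - y                  ≈⟨ +-congʳ (xyx⁻¹≈y 1# x) ⟨
    1# + x + - 1# + - y    ≈⟨ +-assoc (1# + x) (- 1#) (- y) ⟩
    1# + x + (- 1# + - y)  ≈⟨ +-congˡ (-‿+-comm 1# y) ⟩
    (1# + x) - (1# + y)    ≈⟨ +-cong (1+× m 1#) (-‿cong (1+× n 1#)) ⟨
    suc m ×ᴺ 1# - suc n ×ᴺ 1# ∎
    where x = m ×ᴺ 1#; y = n ×ᴺ 1#

  ⟦⟧-+ : ∀ i j → ⟦ i ℤ.+ j ⟧ℤ ≈ ⟦ i ⟧ℤ + ⟦ j ⟧ℤ
  ⟦⟧-+ (+ m)    (+ n)    = ×-homo-+ 1# m n
  ⟦⟧-+ (+ m)    -[1+ n ] = ⟦⟧-⊖ m (suc n)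
  ⟦⟧-+ -[1+ m ] (+ n)    = trans (⟦⟧-⊖ n (suc m)) (+-comm _ _)
  ⟦⟧-+ -[1+ m ] -[1+ n ] = begin
    ⟦ -[1+ m ] ℤ.+ -[1+ n ] ⟧ℤ      ≈⟨ ⟦⟧-cong (ℤ.neg-distrib-+ (+ suc m) (+ suc n)) ⟨
    ⟦ ℤ.- (+ suc m ℤ.+ + suc n) ⟧ℤ  ≈⟨ ⟦⟧-neg (+ suc m ℤ.+ + suc n) ⟩
    - ⟦ + suc m ℤ.+ + suc n ⟧ℤ      ≈⟨ -‿cong (×-homo-+ 1# (suc m) (suc n)) ⟩
    - (suc m ×ᴺ 1# + suc n ×ᴺ 1#)   ≈⟨ -‿+-comm _ _ ⟨
    ⟦ -[1+ m ] ⟧ℤ + ⟦ -[1+ n ] ⟧ℤ   ∎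

  ⟦⟧-*-pos : ∀ m j → ⟦ + m ℤ.* j ⟧ℤ ≈ ⟦ + m ⟧ℤ * ⟦ j ⟧ℤ
  ⟦⟧-*-pos m (+ n)    = trans (⟦⟧-cong (≡.sym (ℤ.pos-* m n))) (×1-homo-* m n)
  ⟦⟧-*-pos m -[1+ n ] = begin
    ⟦ + m ℤ.* ℤ.- + suc n ⟧ℤ    ≈⟨ ⟦⟧-cong (ℤ.neg-distribʳ-* (+ m) (+ suc n)) ⟨
    ⟦ ℤ.- (+ m ℤ.* + suc n) ⟧ℤ  ≈⟨ ⟦⟧-neg (+ m ℤ.* + suc n) ⟩
    - ⟦ + m ℤ.* + suc n ⟧ℤ      ≈⟨ -‿cong (⟦⟧-*-pos m (+ suc n)) ⟩
    - (m ×ᴺ 1# * suc n ×ᴺ 1#)   ≈⟨ -‿distribʳ-* _ _ ⟩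
    m ×ᴺ 1# * ⟦ -[1+ n ] ⟧ℤ     ∎

  ⟦⟧-* : ∀ i j → ⟦ i ℤ.* j ⟧ℤ ≈ ⟦ i ⟧ℤ * ⟦ j ⟧ℤ
  ⟦⟧-* (+ m)    j = ⟦⟧-*-pos m j
  ⟦⟧-* -[1+ m ] j = begin
    ⟦ ℤ.- + suc m ℤ.* j ⟧ℤ      ≈⟨ ⟦⟧-cong (ℤ.neg-distribˡ-* (+ suc m) j) ⟨
    ⟦ ℤ.- (+ suc m ℤ.* j) ⟧ℤ    ≈⟨ ⟦⟧-neg (+ suc m ℤ.* j) ⟩
    - ⟦ + suc m ℤ.* j ⟧ℤ        ≈⟨ -‿cong (⟦⟧-*-pos (suc m) j) ⟩
    - (suc m ×ᴺ 1# * ⟦ j ⟧ℤ)    ≈⟨ -‿distribˡ-* _ _ ⟩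
    ⟦ -[1+ m ] ⟧ℤ * ⟦ j ⟧ℤ      ∎

  homomorphism : ℤ.+-*-rawRing -Raw-AlmostCommutative⟶ fromCommutativeRing R
  homomorphism = record
    { ⟦_⟧ = ⟦_⟧ℤ ; +-homo = ⟦⟧-+ ; *-homo = ⟦⟧-* ; -‿homo = ⟦⟧-neg
    ; 0-homo = refl ; 1-homo = refl }

  _≟-coeff_ : ∀ i j → Maybe (⟦ i ⟧ℤ ≈ ⟦ j ⟧ℤ)
  i ≟-coeff j with i ℤ.≟ j
  ... | yes i≡j = just (⟦⟧-cong i≡j)
  ... | no _    = nothing

  open import Algebra.Solver.Ring ℤ.+-*-rawRing (fromCommutativeRing R) homomorphism _≟-coeff_
    public

module Telescoping {a ℓ} (R : CommutativeRing a ℓ) where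

  open CommutativeRing R
  open import Relation.Binary.Reasoning.Setoid setoid

  Σ₁ : (ℕ → Carrier) → ℕ → Carrier
  Σ₁ x zero    = 0#
  Σ₁ x (suc n) = Σ₁ x n + x (suc n)

  telescope : (k : Carrier) (x E : ℕ → Carrier) →
              (∀ n → E (suc n) ≈ E n + k * x (suc n)) →
              ∀ n → E n ≈ E 0 + k * Σ₁ x n
  telescope k x E step zero = sym (trans (+-congˡ (zeroʳ k)) (+-identityʳ (E 0)))
  telescope k x E step (suc n) = begin
    E (suc n)                              ≈⟨ step n ⟩
    E n + k * x (suc n)                    ≈⟨ +-congʳ (telescope k x E step n) ⟩
    E 0 + k * Σ₁ x n + k * x (suc n)       ≈⟨ +-assoc (E 0) _ _ ⟩
    E 0 + (k * Σ₁ x n + k * x (suc n))     ≈⟨ +-congˡ (distribˡ k (Σ₁ x n) (x (suc n))) ⟨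
    E 0 + k * Σ₁ x (suc n)                 ∎

module StepTwoRecurrence {a ℓ} (R : CommutativeRing a ℓ) where

  open CommutativeRing R
  open IntegerCoefficients R using (solve; _:=_; _:+_; _:*_; _:-_; con)
  open Telescoping R
  open import Relation.Binary.Reasoning.Setoid setoid

  module _ (A B : Carrier) (g : ℕ → Carrier)
           (recurrence : ∀ t → g (4 ℕ.+ t) ≈ A * g (2 ℕ.+ t) - B * g t) where

    potential : ℕ → Carrier
    potential n = B * (g (suc n) + g n) - g (3 ℕ.+ n) - g (2 ℕ.+ n)

    potential-step : ∀ n → potential (suc n) ≈ potential n + (1# - A + B) * g (2 ℕ.+ n)
    potential-step n = begin
      B * (g₂ + g₁) - g₄ - g₃                     ≈⟨ +-congʳ (+-congˡ (-‿cong (recurrence n))) ⟩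
      B * (g₂ + g₁) - (A * g₂ - B * g₀) - g₃      ≈⟨ solve 6 (λ A B g₀ g₁ g₂ g₃ →
          B :* (g₂ :+ g₁) :- (A :* g₂ :- B :* g₀) :- g₃
        := B :* (g₁ :+ g₀) :- g₃ :- g₂ :+ (con (+ 1) :- A :+ B) :* g₂) refl A B g₀ g₁ g₂ g₃ ⟩
      B * (g₁ + g₀) - g₃ - g₂ + (1# - A + B) * g₂ ∎
      where
      g₀ = g n; g₁ = g (1 ℕ.+ n); g₂ = g (2 ℕ.+ n); g₃ = g (3 ℕ.+ n); g₄ = g (4 ℕ.+ n)

    sum-formula : ∀ n →
      (1# - A + B) * Σ₁ (λ r → g (suc r)) n
        ≈ B * (g (suc n) + g n - g 1 - g 0) - g (3 ℕ.+ n) - g (2 ℕ.+ n) + g 3 + g 2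
    sum-formula n = begin
      k * S                          ≈⟨ solve 2 (λ E₀ kS → kS := E₀ :+ kS :- E₀) refl (potential 0) (k * S) ⟩
      potential 0 + k * S - potential 0
        ≈⟨ +-congʳ (telescope k (λ r → g (suc r)) potential potential-step n) ⟨
      potential n - potential 0      ≈⟨ solve 9 (λ B g₀ g₁ g₂ g₃ gₙ gₙ₁ gₙ₂ gₙ₃ →
          B :* (gₙ₁ :+ gₙ) :- gₙ₃ :- gₙ₂ :- (B :* (g₁ :+ g₀) :- g₃ :- g₂)
        := B :* (gₙ₁ :+ gₙ :- g₁ :- g₀) :- gₙ₃ :- gₙ₂ :+ g₃ :+ g₂)
          refl B (g 0) (g 1) (g 2) (g 3) (g n) (g (1 ℕ.+ n)) (g (2 ℕ.+ n)) (g (3 ℕ.+ n)) ⟩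
      B * (g (suc n) + g n - g 1 - g 0) - g (3 ℕ.+ n) - g (2 ℕ.+ n) + g 3 + g 2 ∎
      where
      k = 1# - A + B
      S = Σ₁ (λ r → g (suc r)) n

module HoradamHybrid (R : RealField) where

  open RealField R
  open Theory R

  commutativeRing : CommutativeRing 0ℓ 0ℓ
  commutativeRing = record { isCommutativeRing = isCommutativeRing }

  open CommutativeRing commutativeRing using (*-assoc; *-comm; *-identityˡ)
  open IntegerCoefficients commutativeRing using (solve; _:=_; _:+_; _:*_; _:-_; :-_; con)
  open Telescoping commutativeRing using (Σ₁)
  open StepTwoRecurrence commutativeRing using (sum-formula)
  open ≡.≡-Reasoning

  divide : (d : Carrier) (d≢0 : d ≢ 0#) {s m : Carrier} → d * s ≡ m → s ≡ (d ⁻¹) d≢0 * m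
  divide d d≢0 {s} {m} ds≡m = begin
    s                ≡⟨ *-identityˡ s ⟨
    1# * s           ≡⟨ cong (_* s) (≡.trans (*-comm d⁻¹ d) (⁻¹-inverse d d≢0)) ⟨
    d⁻¹ * d * s      ≡⟨ *-assoc d⁻¹ d s ⟩
    d⁻¹ * (d * s)    ≡⟨ cong (d⁻¹ *_) ds≡m ⟩
    d⁻¹ * m          ∎
    where d⁻¹ = (d ⁻¹) d≢0

  hyb-cong : {x y z t x′ y′ z′ t′ : Carrier} →
             x ≡ x′ → y ≡ y′ → z ≡ z′ → t ≡ t′ → hyb x y z t ≡ hyb x′ y′ z′ t′
  hyb-cong ≡.refl ≡.refl ≡.refl ≡.refl = ≡.refl

  sumFrom1-components : ∀ (f : ℕ → Hybrid Carrier) n →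
    sumFrom1 f n ≡ hyb (Σ₁ (λ r → Hybrid.re (f r)) n) (Σ₁ (λ r → Hybrid.ci (f r)) n)
                       (Σ₁ (λ r → Hybrid.ce (f r)) n) (Σ₁ (λ r → Hybrid.ch (f r)) n)
  sumFrom1-components f zero    = ≡.refl
  sumFrom1-components f (suc n) = cong (_⊕ f (suc n)) (sumFrom1-components f n)

  module _ (a b c w₀ w₁ : Carrier) (a≢0 : a ≢ 0#) (c≢0 : c ≢ 0#) where

    -- w⁺ t = w_{t-1}: the sequence w_{-1}, w_0, w_1, … indexed from 0.
    w⁺ : ℕ → Carrier
    w⁺ zero    = w a b c w₀ w₁ a≢0 c≢0 -[1+ 0 ]
    w⁺ (suc t) = wN a b c w₀ w₁ t

    χ-product : ∀ n → χ a b n * χ a b (suc n) ≡ a * b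
    χ-product zero          = ≡.refl
    χ-product (suc zero)    = *-comm b a
    χ-product (suc (suc n)) = χ-product n

    -- The definition (-c) w_{-1} = (b/a) w₀ u₂ - w₁ u₁, with u₁ = 1 and u₂ = a.
    c·w₋₁ : c * w⁺ 0 ≡ w₁ - b * w₀
    c·w₋₁ = begin
      c * ((- c⁻¹ * 1#) * ((b * a⁻¹) * 1# * w₀ * (a * 1# + c * 0#) - w₁ * 1#))
        ≡⟨ solve 7 (λ c c⁻¹ b a⁻¹ a w₀ w₁ →
             c :* ((:- c⁻¹ :* con (+ 1)) :* ((b :* a⁻¹) :* con (+ 1) :* w₀ :* (a :* con (+ 1) :+ c :* con (+ 0))
                                             :- w₁ :* con (+ 1)))
             := :- (c :* c⁻¹) :* ((a :* a⁻¹) :* b :* w₀ :- w₁)) ≡.refl c c⁻¹ b a⁻¹ a w₀ w₁ ⟩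
      - (c * c⁻¹) * ((a * a⁻¹) * b * w₀ - w₁)
        ≡⟨ ≡.cong₂ (λ x y → - x * (y * b * w₀ - w₁)) (⁻¹-inverse c c≢0) (⁻¹-inverse a a≢0) ⟩
      - 1# * (1# * b * w₀ - w₁)
        ≡⟨ solve 3 (λ b w₀ w₁ → :- con (+ 1) :* (con (+ 1) :* b :* w₀ :- w₁) := w₁ :- b :* w₀)
                   ≡.refl b w₀ w₁ ⟩
      w₁ - b * w₀ ∎
      where c⁻¹ = (c ⁻¹) c≢0; a⁻¹ = (a ⁻¹) a≢0

    A D : Carrier
    A = (1# + 1#) * c + a * b
    D = c * c - a * b - (1# + 1#) * c + 1#

    denominator : 1# - A + c * c ≡ D
    denominator = solve 3 (λ a b c →
        con (+ 1) :- ((con (+ 1) :+ con (+ 1)) :* c :+ a :* b) :+ c :* c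
      := c :* c :- a :* b :- (con (+ 1) :+ con (+ 1)) :* c :+ con (+ 1)) ≡.refl a b c

    w⁺-recurrence : ∀ t → w⁺ (4 ℕ.+ t) ≡ A * w⁺ (2 ℕ.+ t) - c * c * w⁺ t
    w⁺-recurrence zero = begin
      b * (a * w₁ + c * w₀) + c * w₁
        ≡⟨ solve 5 (λ a b c w₀ w₁ →
             b :* (a :* w₁ :+ c :* w₀) :+ c :* w₁
             := ((con (+ 1) :+ con (+ 1)) :* c :+ a :* b) :* w₁ :- c :* (w₁ :- b :* w₀)) ≡.refl a b c w₀ w₁ ⟩
      A * w₁ - c * (w₁ - b * w₀)         ≡⟨ cong (λ x → A * w₁ - c * x) c·w₋₁ ⟨
      A * w₁ - c * (c * w⁺ 0)            ≡⟨ cong (λ x → A * w₁ - x) (*-assoc c c (w⁺ 0)) ⟨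
      A * w₁ - c * c * w⁺ 0              ∎
    w⁺-recurrence (suc s) = begin
      p * (q * (p * X + c * Y) + c * X) + c * (p * X + c * Y)
        ≡⟨ solve 5 (λ p q c X Y →
             p :* (q :* (p :* X :+ c :* Y) :+ c :* X) :+ c :* (p :* X :+ c :* Y)
             := ((con (+ 1) :+ con (+ 1)) :* c :+ p :* q) :* (p :* X :+ c :* Y) :- c :* c :* Y)
           ≡.refl p q c X Y ⟩
      ((1# + 1#) * c + p * q) * (p * X + c * Y) - c * c * Y
        ≡⟨ cong (λ x → ((1# + 1#) * c + x) * (p * X + c * Y) - c * c * Y) (χ-product (2 ℕ.+ s)) ⟩
      A * (p * X + c * Y) - c * c * Y    ∎
      where
      p = χ a b (2 ℕ.+ s); q = χ a b (3 ℕ.+ s)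
      X = wN a b c w₀ w₁ (suc s); Y = wN a b c w₀ w₁ s

    -- The scalar form of the theorem, for any sequence with the recurrence of w⁺;
    -- the indices n + 3, n + 2 are written as in the theorem.
    scalar-sum : (D≢0 : D ≢ 0#) (g : ℕ → Carrier) →
      (∀ t → g (4 ℕ.+ t) ≡ A * g (2 ℕ.+ t) - c * c * g t) → ∀ n →
      Σ₁ (λ r → g (suc r)) n
        ≡ (D ⁻¹) D≢0 * (c * c * (g (suc n) + g n - g 1 - g 0)
                        - g (suc (n ℕ.+ 2)) - g (suc (n ℕ.+ 1)) + g 3 + g 2)
    scalar-sum D≢0 g recurrence n rewrite ℕ.+-comm n 2 | ℕ.+-comm n 1 =
      divide D D≢0 (≡.trans (cong (_* Σ₁ (λ r → g (suc r)) n) (≡.sym denominator))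
                            (sum-formula A (c * c) g recurrence n))

    hybrid-sum : (D≢0 : D ≢ 0#) → ∀ k →
      let K = 𝕂 a b c w₀ w₁ a≢0 c≢0 in
      sumFrom1 (λ r → K (+ r)) (suc k)
        ≡ (D ⁻¹) D≢0
          · ((c * c) · (K (+ suc k) ⊕ K (+ k) ⊖ K (+ 0) ⊖ K -[1+ 0 ])
             ⊖ K (+ (suc k ℕ.+ 2)) ⊖ K (+ (suc k ℕ.+ 1)) ⊕ K (+ 2) ⊕ K (+ 1))
    hybrid-sum D≢0 k = ≡.trans (sumFrom1-components _ (suc k))
      (hyb-cong (scalar-sum D≢0 w⁺ w⁺-recurrence (suc k))
                (shifted 1) (shifted 2) (shifted 3))
      where
      -- Component j of 𝕂_{w,r} is w_{r+j} = w⁺ (r + 1 + j); the shifted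
      -- sequence inherits the recurrence.
      shifted : ∀ j → Σ₁ (λ r → w⁺ (suc r ℕ.+ j)) (suc k) ≡
        (D ⁻¹) D≢0 * (c * c * (w⁺ (2 ℕ.+ k ℕ.+ j) + w⁺ (1 ℕ.+ k ℕ.+ j) - w⁺ (1 ℕ.+ j) - w⁺ j)
                      - w⁺ (suc (suc k ℕ.+ 2) ℕ.+ j) - w⁺ (suc (suc k ℕ.+ 1) ℕ.+ j)
                      + w⁺ (3 ℕ.+ j) + w⁺ (2 ℕ.+ j))
      shifted j = scalar-sum D≢0 (λ i → w⁺ (i ℕ.+ j)) (λ t → w⁺-recurrence (t ℕ.+ j)) (suc k)

-- Only c ≠ 0 (needed to define w_{-1}), a ≠ 0 (likewise) and the
-- nonvanishing denominator are used; the identity does not depend on b ≠ 0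
-- or on the sign of a²b² + 4abc.  For n = k + 1 the index n - 1 computes
-- to k, so the statement is hybrid-sum.
mainTheorem8 : (R : RealField) →
    let open RealField R
        open Theory R
    in
    (a b c w₀ w₁ : Carrier) (a≢0 : a ≢ 0#) (b≢0 : b ≢ 0#) (c≢0 : c ≢ 0#) →
    0# < a * a * (b * b) + (1# + 1# + 1# + 1#) * a * b * c →
    (D≢0 : c * c - a * b - (1# + 1#) * c + 1# ≢ 0#) →
    (n : ℕ) → n ≥ 1 →
    let K = 𝕂 a b c w₀ w₁ a≢0 c≢0
    in
    sumFrom1 (λ r → K (+ r)) n
      ≡ ((c * c - a * b - (1# + 1#) * c + 1#) ⁻¹) D≢0
        · ((c * c) · (K (+ n) ⊕ K (+ n Data.Integer.- + 1) ⊖ K (+ 0) ⊖ K -[1+ 0 ])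
           ⊖ K (+ (n Data.Nat.+ 2)) ⊖ K (+ (n Data.Nat.+ 1)) ⊕ K (+ 2) ⊕ K (+ 1))
mainTheorem8 R a b c w₀ w₁ a≢0 _ c≢0 _ D≢0 (suc k) _ =
  HoradamHybrid.hybrid-sum R a b c w₀ w₁ a≢0 c≢0 D≢0 k
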